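{- The Mockingbird combinatory logic system satisfies: (i) it is locally finite, i.e. every $\equiv$-equivalence class of terms is finite; (ii) it has the poset property, i.e. $\preccurlyeq$ is antisymmetric (hence a partial order on terms); (iii) it is rooted, i.e. every $\equiv$-equivalence class of terms has a unique minimal element with respect to $\preccurlyeq$.
   Context: Terms over $\{\mathsf{M}\}$: every variable $\mathsf{x}_i$ ($i\ge1$) is a term, $\mathsf{M}$ is a term, and if $\mathfrak{t}_1,\mathfrak{t}_2$ are terms so is the application $\mathfrak{t}_1\mathfrak{t}_2$ (binary tree with left subtree $\mathfrak{t}_1$, right subtree $\mathfrak{t}_2$). The Mockingbird system has the single rule $\mathsf{M}\mathsf{x}_1 \to \mathsf{x}_1\mathsf{x}_1$; its context closure $\Rightarrow$ is: $\mathfrak{t}\Rightarrow\mathfrak{t}'$ iff $\mathfrak{t}'$ is obtained from $\mathfrak{t}$ by replacing one subterm of the form $\mathsf{M}\mathfrak{s}$ by $\mathfrak{s}\mathfrak{s}$. $\preccurlyeq$ is the reflexive and transitive closure of $\Rightarrow$, and $\equiv$ is its reflexive, symmetric and transitive closure. -}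

module Defs where

open import Data.Nat using (ℕ)
open import Data.List using (List)
open import Data.List.Membership.Propositional using (_∈_)
open import Data.Product using (Σ; _×_)
open import Function.Bundles using (_⇔_)
open import Relation.Binary.PropositionalEquality using (_≡_)
open import Relation.Binary.Construct.Closure.ReflexiveTransitive using (Star)
open import Relation.Binary.Construct.Closure.Equivalence using (EqClosure)

infixl 9 _·_

-- Terms over {M}.  'var n' stands for the variable x_(n+1) (variables x_1, x_2, ...).
data Term : Set where
  var : ℕ → Term
  M   : Term
  _·_ : Term → Term → Term

infix 4 _⇒_
data _⇒_ : Term → Term → Set where
  root : ∀ {s} → M · s ⇒ s · s
  appL : ∀ {t t′ u} → t ⇒ t′ → t · u ⇒ t′ · u
  appR : ∀ {t u u′} → u ⇒ u′ → t · u ⇒ t · u′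

infix 4 _≼_
_≼_ : Term → Term → Set
_≼_ = Star _⇒_

infix 4 _≋_
_≋_ : Term → Term → Set
_≋_ = EqClosure _⇒_

LocallyFinite : Set
LocallyFinite = ∀ t → Σ (List Term) λ L → ∀ s → (s ∈ L ⇔ t ≋ s)

PosetProperty : Set
PosetProperty = ∀ t s → t ≼ s → s ≼ t → t ≡ s

MinimalIn : Term → Term → Set
MinimalIn t m = (t ≋ m) × (∀ s → t ≋ s → s ≼ m → s ≡ m)

Rooted : Set
Rooted = ∀ t → Σ Term λ m → MinimalIn t m × (∀ m′ → MinimalIn t m′ → m′ ≡ m)

-- A Mockingbird step never changes the term obtained by collapsing, bottom-up, every square
-- a · a into M · a; this collapsed form lies below its term, and two terms with the same
-- collapsed form are ≋-equivalent through it.  So ≋-classes are exactly the fibres of the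
-- collapse, and the collapsed form is the least element of its class.  A fibre is finite
-- because the collapse can be undone in only finitely many ways.  Finally, every step other
-- than M · M ⇒ M · M strictly increases the weight counting M as 1 and variables as 2, so
-- ≼ is antisymmetric, and the least element of a class is its unique minimal one.
module Submission where

open import Defs
open import Data.Product using (_×_; _,_; proj₁; proj₂)
open import Data.Nat using (ℕ; _+_; _≤_; _<_; s≤s; z≤n)
import Data.Nat as ℕ
open import Data.Nat.Properties using (≤-refl; ≤-trans; <-trans; <-irrefl; m≤m+n; +-mono-≤; +-monoˡ-<; +-monoʳ-<)
open import Data.Sum using (_⊎_; inj₁; inj₂)
open import Data.Empty using (⊥-elim)
open import Data.List using (List; []; _∷_; _++_; filter; cartesianProductWith)
open import Data.List.Membership.Propositional using (_∈_)
open import Data.List.Membership.Propositional.Properties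
  using (∈-++⁺ˡ; ∈-++⁺ʳ; ∈-cartesianProductWith⁺; ∈-filter⁺; ∈-filter⁻)
open import Data.List.Relation.Unary.Any using (here)
open import Relation.Nullary using (Dec; yes; no; ¬_)
open import Relation.Binary.PropositionalEquality
  using (_≡_; refl; sym; trans; cong; subst; isEquivalence)
open import Relation.Binary.Construct.Closure.ReflexiveTransitive as Star
  using (Star; ε; _◅_; _◅◅_)
open import Relation.Binary.Construct.Closure.Symmetric using (fwd)
import Relation.Binary.Construct.Closure.Equivalence as EqClosure
open import Function.Bundles using (mk⇔)

module _ {A : Set} {R : A → A → Set} (f : A → ℕ)
         (grows : ∀ {x y} → R x y → x ≡ y ⊎ f x < f y) where

  star-grows : ∀ {x y} → Star R x y → x ≡ y ⊎ f x < f y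
  star-grows ε = inj₁ refl
  star-grows (r ◅ rs) with grows r | star-grows rs
  ... | inj₁ refl | q         = q
  ... | inj₂ lt   | inj₁ refl = inj₂ lt
  ... | inj₂ lt   | inj₂ lt′  = inj₂ (<-trans lt lt′)

  star-antisym : ∀ {x y} → Star R x y → Star R y x → x ≡ y
  star-antisym xy yx with star-grows xy | star-grows yx
  ... | inj₁ x≡y | _        = x≡y
  ... | inj₂ _   | inj₁ y≡x = sym y≡x
  ... | inj₂ lt  | inj₂ lt′ = ⊥-elim (<-irrefl refl (<-trans lt lt′))

·-injective : ∀ {a b c d} → a · b ≡ c · d → a ≡ c × b ≡ d
·-injective refl = refl , refl

_≟_ : (a b : Term) → Dec (a ≡ b)
var m ≟ var n with m ℕ.≟ n
... | yes refl = yes refl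
... | no m≢n   = no λ { refl → m≢n refl }
M ≟ M = yes refl
(a · b) ≟ (c · d) with a ≟ c | b ≟ d
... | yes refl | yes refl = yes refl
... | no a≢c   | _        = no λ e → a≢c (proj₁ (·-injective e))
... | yes _    | no b≢d   = no λ e → b≢d (proj₂ (·-injective e))
var _ ≟ M = no λ ()
var _ ≟ (_ · _) = no λ ()
M ≟ var _ = no λ ()
M ≟ (_ · _) = no λ ()
(_ · _) ≟ var _ = no λ ()
(_ · _) ≟ M = no λ ()

collapse : Term → Term → Term
collapse a b with a ≟ b
... | yes _ = M · a
... | no _  = a · b

nf : Term → Term
nf (var n) = var n
nf M       = M
nf (t · u) = collapse (nf t) (nf u)

collapse-diag : ∀ a → collapse a a ≡ M · a
collapse-diag a with a ≟ a
... | yes _  = refl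
... | no a≢a = ⊥-elim (a≢a refl)

collapse-M : ∀ a → collapse M a ≡ M · a
collapse-M a with M ≟ a
... | yes refl = refl
... | no _     = refl

nf-respects-⇒ : ∀ {t s} → t ⇒ s → nf t ≡ nf s
nf-respects-⇒ (root {s})          = trans (collapse-M (nf s)) (sym (collapse-diag (nf s)))
nf-respects-⇒ (appL {u = u} t⇒t′) = cong (λ a → collapse a (nf u)) (nf-respects-⇒ t⇒t′)
nf-respects-⇒ (appR {t = t} u⇒u′) = cong (collapse (nf t)) (nf-respects-⇒ u⇒u′)

nf-respects-≋ : ∀ {t s} → t ≋ s → nf t ≡ nf s
nf-respects-≋ = EqClosure.gfold isEquivalence nf nf-respects-⇒

≼-congˡ : ∀ {t t′ u} → t ≼ t′ → t · u ≼ t′ · u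
≼-congˡ = Star.gmap _ appL

≼-congʳ : ∀ {t u u′} → u ≼ u′ → t · u ≼ t · u′
≼-congʳ = Star.gmap _ appR

collapse-≼ : ∀ a b → collapse a b ≼ a · b
collapse-≼ a b with a ≟ b
... | yes refl = root ◅ ε
... | no _     = ε

nf-≼ : ∀ t → nf t ≼ t
nf-≼ (var n) = ε
nf-≼ M       = ε
nf-≼ (t · u) = collapse-≼ (nf t) (nf u) ◅◅ ≼-congˡ (nf-≼ t) ◅◅ ≼-congʳ (nf-≼ u)

≼⇒≋ : ∀ {t s} → t ≼ s → t ≋ s
≼⇒≋ = Star.map fwd

≋-nf : ∀ t → t ≋ nf t
≋-nf t = EqClosure.symmetric _⇒_ (≼⇒≋ (nf-≼ t))

nf≡⇒≋ : ∀ {t s} → nf t ≡ nf s → t ≋ s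
nf≡⇒≋ {t} {s} nf≡ = ≋-nf t ◅◅ subst (_≋ s) (sym nf≡) (EqClosure.symmetric _⇒_ (≋-nf s))

nf-≼-≋ : ∀ {t s} → t ≋ s → nf t ≼ s
nf-≼-≋ {s = s} t≋s = subst (_≼ s) (sym (nf-respects-≋ t≋s)) (nf-≼ s)

weight : Term → ℕ
weight (var _) = 2
weight M       = 1
weight (t · u) = weight t + weight u

1≤weight : ∀ t → 1 ≤ weight t
1≤weight (var _) = s≤s z≤n
1≤weight M       = ≤-refl
1≤weight (t · u) = ≤-trans (1≤weight t) (m≤m+n _ _)

2≤weight : ∀ t → ¬ t ≡ M → 2 ≤ weight t
2≤weight (var _) _   = ≤-refl
2≤weight M       t≢M = ⊥-elim (t≢M refl)
2≤weight (t · u) _   = +-mono-≤ (1≤weight t) (1≤weight u)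

⇒-weight : ∀ {t s} → t ⇒ s → t ≡ s ⊎ weight t < weight s
⇒-weight (root {s}) with s ≟ M
... | yes refl = inj₁ refl
... | no s≢M   = inj₂ (+-monoˡ-< (weight s) (2≤weight s s≢M))
⇒-weight (appL {u = u} t⇒t′) with ⇒-weight t⇒t′
... | inj₁ refl = inj₁ refl
... | inj₂ lt   = inj₂ (+-monoˡ-< (weight u) lt)
⇒-weight (appR {t = t} u⇒u′) with ⇒-weight u⇒u′
... | inj₁ refl = inj₁ refl
... | inj₂ lt   = inj₂ (+-monoʳ-< (weight t) lt)

≼-antisym : PosetProperty
≼-antisym _ _ = star-antisym weight ⇒-weight

-- A term t · u collapses to a · b either with nf t ≡ a and nf u ≡ b, or, when it is a
-- square, with a ≡ M and nf t ≡ nf u ≡ b.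
unfoldings : Term → List Term
unfoldings (var n) = var n ∷ []
unfoldings M       = M ∷ []
unfoldings (a · b) = cartesianProductWith _·_ (unfoldings a) (unfoldings b)
                  ++ cartesianProductWith _·_ (unfoldings b) (unfoldings b)

∈-unfoldings-nf : ∀ s → s ∈ unfoldings (nf s)
∈-unfoldings-nf (var n) = here refl
∈-unfoldings-nf M       = here refl
∈-unfoldings-nf (t · u) with nf t ≟ nf u
... | yes nft≡nfu = ∈-++⁺ʳ (cartesianProductWith _·_ (unfoldings M) (unfoldings (nf t)))
                      (∈-cartesianProductWith⁺ _·_ (∈-unfoldings-nf t)
                        (subst (λ a → u ∈ unfoldings a) (sym nft≡nfu) (∈-unfoldings-nf u)))
... | no _        = ∈-++⁺ˡ (∈-cartesianProductWith⁺ _·_ (∈-unfoldings-nf t) (∈-unfoldings-nf u))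

locallyFinite : LocallyFinite
locallyFinite t = filter sameClass (unfoldings (nf t)) , λ s → mk⇔
  (λ s∈ → EqClosure.symmetric _⇒_ (nf≡⇒≋ (proj₂ (∈-filter⁻ sameClass {xs = unfoldings (nf t)} s∈))))
  (λ t≋s → let nfs≡nft = sym (nf-respects-≋ t≋s) in
    ∈-filter⁺ sameClass (subst (λ a → s ∈ unfoldings a) nfs≡nft (∈-unfoldings-nf s)) nfs≡nft)
  where
  sameClass : ∀ s → Dec (nf s ≡ nf t)
  sameClass s = nf s ≟ nf t

rooted : Rooted
rooted t = nf t , (≋-nf t , minimal) , unique
  where
  minimal : ∀ s → t ≋ s → s ≼ nf t → s ≡ nf t
  minimal s t≋s s≼nf = ≼-antisym s (nf t) s≼nf (nf-≼-≋ t≋s)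

  unique : ∀ m → MinimalIn t m → m ≡ nf t
  unique m (t≋m , m-minimal) = sym (m-minimal (nf t) (≋-nf t) (nf-≼-≋ t≋m))

proposition2p1p2 : LocallyFinite × PosetProperty × Rooted
proposition2p1p2 = locallyFinite , ≼-antisym , rooted
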